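{- Let $n\ge1$, $d\ge0$. The restrictions of the operators $T_s$, $T_K$ and $T_I$ to the set of sorted compact configurations on $S_{n,d}$ commute pairwise, and $T_sT_K^{n}T_I^{d}=\mathsf{Id}$ on this set.
   Context: The complete split graph $S_{n,d}$ has a sink $s$, clique component $K=\{v_1,\ldots,v_n\}$ and independent component $I=\{w_1,\ldots,w_d\}$; any two distinct vertices among $s,v_1,\ldots,v_n$ are adjacent, each $w_j$ is adjacent to each of $s,v_1,\ldots,v_n$, no two $w_j$'s are adjacent; $\deg(v_i)=\deg(s)=n+d$, $\deg(w_j)=n+1$. A configuration is any $u=(u^{[K]};u^{[I]})\in\mathbb{Z}^n\times\mathbb{Z}^d$, the sink carrying $u_s=-(\text{sum of all entries})$. $\Delta^{(v)}$ is the toppling vector of vertex $v$ (including $s$): adding it removes $\deg(v)$ grains from $v$ and adds one grain to each neighbour. A configuration is sorted if $u^{[K]}$ and $u^{[I]}$ are weakly decreasing; $\mathsf{sort}(u)$ sorts each of $u^{[K]}$, $u^{[I]}$ into weakly decreasing order. $u$ is compact if $\max u^{[K]}-\min u^{[K]}\le n+d+1$ and $\max u^{[I]}-\min u^{[I]}\le n+1$. Operators: $T_s.u=\mathsf{sort}(u+\Delta^{(s)})$, and for $C\in\{K,I\}$, $T_C.u=\mathsf{sort}(u+\Delta^{(c)})$ where $c$ is a vertex of $C$ carrying the maximal number of grains within $C$. (These operators map sorted compact configurations to sorted compact configurations.) -}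

module Defs where

open import Data.Nat as ℕ using (ℕ; zero; suc)
open import Data.Integer as ℤ using (ℤ; +_; _-_; _≤_; _≤?_)
open import Data.Fin as Fin using (Fin; zero; suc)
open import Data.Vec using (Vec; []; _∷_; lookup; tabulate; map)
open import Data.Product using (_×_; _,_; proj₁; proj₂)
open import Relation.Nullary using (yes; no)

-- Configurations on S_{n,d}: the values on the clique K = {v_1..v_n} and on the
-- independent set I = {w_1..w_d}; the sink value is determined (minus the total).
Config : ℕ → ℕ → Set
Config n d = Vec ℤ n × Vec ℤ d

Decreasing : ∀ {m} → Vec ℤ m → Set
Decreasing {m} v = (i j : Fin m) → i Fin.≤ j → lookup v j ≤ lookup v i

SpreadAtMost : ∀ {m} → ℕ → Vec ℤ m → Set
SpreadAtMost {m} b v = (i j : Fin m) → lookup v i - lookup v j ≤ + b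

Sorted : ∀ {n d} → Config n d → Set
Sorted (k , w) = Decreasing k × Decreasing w

Compact : ∀ {n d} → Config n d → Set
Compact {n} {d} (k , w) = SpreadAtMost (n ℕ.+ d ℕ.+ 1) k × SpreadAtMost (n ℕ.+ 1) w

insert : ∀ {m} → ℤ → Vec ℤ m → Vec ℤ (suc m)
insert x [] = x ∷ []
insert x (y ∷ ys) with y ≤? x
... | yes _ = x ∷ y ∷ ys
... | no _  = y ∷ insert x ys

sortVec : ∀ {m} → Vec ℤ m → Vec ℤ m
sortVec [] = []
sortVec (x ∷ xs) = insert x (sortVec xs)

sort : ∀ {n d} → Config n d → Config n d
sort (k , w) = sortVec k , sortVec w

argmax : ∀ {m} → Vec ℤ (suc m) → Fin (suc m)
argmax (x ∷ []) = zero
argmax (x ∷ y ∷ ys) with lookup (y ∷ ys) (argmax (y ∷ ys)) ≤? x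
... | yes _ = zero
... | no _  = suc (argmax (y ∷ ys))

bump : ∀ {m} → Vec ℤ m → Fin m → ℤ → ℤ → Vec ℤ m
bump v i c e = tabulate λ j → case-eq j
  where
  case-eq : Fin _ → ℤ
  case-eq j with j Fin.≟ i
  ... | yes _ = lookup v j ℤ.+ c
  ... | no _  = lookup v j ℤ.+ e

-- u + Δ^(s): every non-sink vertex is adjacent to s
topple-s : ∀ {n d} → Config n d → Config n d
topple-s (k , w) = map (ℤ._+ + 1) k , map (ℤ._+ + 1) w

-- u + Δ^(v_c): v_c loses n+d, other v_i and all w_j gain 1 (and s gains 1)
topple-K : ∀ {n d} → Config n d → Fin n → Config n d
topple-K {n} {d} (k , w) c =
  bump k c (ℤ.- (+ (n ℕ.+ d))) (+ 1) , map (ℤ._+ + 1) w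

-- u + Δ^(w_c): w_c loses n+1, all v_i gain 1 (and s gains 1), other w_j unchanged
topple-I : ∀ {n d} → Config n d → Fin d → Config n d
topple-I {n} {d} (k , w) c =
  map (ℤ._+ + 1) k , bump w c (ℤ.- (+ (n ℕ.+ 1))) (+ 0)

T-s : ∀ {n d} → Config n d → Config n d
T-s u = sort (topple-s u)

-- topple a vertex of K carrying the maximal number of grains in K
-- (for n = 0 there is no such vertex; convention: identity)
T-K : ∀ {n d} → Config n d → Config n d
T-K {zero}  u = u
T-K {suc n} u = sort (topple-K u (argmax (proj₁ u)))

-- topple a vertex of I carrying the maximal number of grains in I
-- (for d = 0 there is no such vertex; convention: identity)
T-I : ∀ {n d} → Config n d → Config n d
T-I {d = zero}  u = u
T-I {d = suc d} u = sort (topple-I u (argmax (proj₂ u)))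

iter : ∀ {A : Set} → ℕ → (A → A) → A → A
iter zero    f x = x
iter (suc k) f x = f (iter k f x)

{-# OPTIONS --safe #-}
-- On a sorted compact configuration the maximal vertex of K is the head x₁ of u^[K], and
-- the spread bound x₁ - xᵢ ≤ n + d + 1 makes it a minimal one once it has toppled, so
-- sorting only moves it to the back: T_K maps u^[K] to (x₂ + 1, …, xₙ + 1, x₁ - (n + d))
-- and adds 1 on I. Likewise T_I rotates u^[I] with loss n + 1 and adds 1 on K, while T_s
-- adds 1 everywhere. Rotations commute with uniform shifts, which gives the commutations,
-- and m rotations of a vector of length m lower every entry by the loss. Hence
-- T_s T_Kⁿ T_Iᵈ changes K by d - (d + 1) + 1 = 0 and I by -(n + 1) + n + 1 = 0.
module Submission where

open import Defs
open import Data.Nat using (ℕ; _≤_)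
open import Data.Product using (_×_)
open import Relation.Binary.PropositionalEquality using (_≡_)

open import Data.Nat as ℕ using (zero; suc)
open import Data.Integer as ℤ using (ℤ; +_; -_; _+_; _-_; _*_; _≥_; _≤?_; 0ℤ; 1ℤ)
import Data.Integer.Properties as ℤₚ
open import Data.Integer.Tactic.RingSolver using (solve-∀)
open import Data.Fin using (zero; suc)
open import Data.Vec as Vec using (Vec; []; _∷_; _∷ʳ_; toList)
import Data.Vec.Properties as Vecₚ
open import Data.Vec.Relation.Unary.All as All using (All; []; _∷_)
import Data.Vec.Relation.Unary.All.Properties as Allₚ
open import Data.Vec.Relation.Unary.Linked as Linked using (Linked; []; [-]; _∷_)
import Data.Vec.Relation.Unary.Linked.Properties as Linkedₚ
open import Data.List as List using (List; _++_; length)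
import Data.List.Properties as Listₚ
open import Data.Product as Product using (_,_; proj₁; proj₂)
open import Data.Unit using (⊤; tt)
open import Data.Empty using (⊥-elim)
open import Function using (_∘_)
open import Relation.Nullary using (yes; no)
open import Relation.Binary.PropositionalEquality
  using (refl; sym; trans; cong; cong₂; subst; subst₂; module ≡-Reasoning)

open ≡-Reasoning

iter-suc : ∀ {A : Set} j (f : A → A) x → iter (suc j) f x ≡ iter j f (f x)
iter-suc zero    f x = refl
iter-suc (suc j) f x = cong f (iter-suc j f x)

iter-intertwine : ∀ {A B : Set} {f : A → A} {g : B → B} (h : A → B) →
                  (∀ x → h (f x) ≡ g (h x)) → ∀ j x → h (iter j f x) ≡ iter j g (h x)
iter-intertwine h hf≡gh zero    x = refl
iter-intertwine {f = f} {g} h hf≡gh (suc j) x =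
  trans (hf≡gh (iter j f x)) (cong g (iter-intertwine h hf≡gh j x))

iter-∘ : ∀ {A : Set} {f g : A → A} → (∀ x → g (f x) ≡ f (g x)) →
         ∀ j x → iter j (f ∘ g) x ≡ iter j f (iter j g x)
iter-∘ gf≡fg zero    x = refl
iter-∘ {f = f} {g} gf≡fg (suc j) x =
  trans (cong (f ∘ g) (iter-∘ gf≡fg j x)) (cong f (iter-intertwine g gf≡fg j (iter j g x)))

iter-map : ∀ {A B : Set} (f : A → A) (g : B → B) j (u : A × B) →
           iter j (Product.map f g) u ≡ (iter j f (proj₁ u) , iter j g (proj₂ u))
iter-map f g j u = cong₂ _,_ (iter-intertwine proj₁ (λ _ → refl) j u)
                             (iter-intertwine proj₂ (λ _ → refl) j u)

record AgreesOn {A : Set} (P : A → Set) (f F : A → A) : Set where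
  field
    agree    : ∀ x → P x → f x ≡ F x
    preserve : ∀ x → P x → P (F x)

open AgreesOn

module _ {A : Set} {P : A → Set} where

  iter-preserves : ∀ {F : A → A} → (∀ x → P x → P (F x)) → ∀ j x → P x → P (iter j F x)
  iter-preserves PF zero    x p = p
  iter-preserves PF (suc j) x p = PF _ (iter-preserves PF j x p)

  iter-agrees : ∀ {f F : A → A} → AgreesOn P f F → ∀ j x → P x → iter j f x ≡ iter j F x
  iter-agrees         f≈F zero    x p = refl
  iter-agrees {f} {F} f≈F (suc j) x p = begin
    f (iter j f x) ≡⟨ cong f (iter-agrees f≈F j x p) ⟩
    f (iter j F x) ≡⟨ agree f≈F _ (iter-preserves (preserve f≈F) j x p) ⟩
    F (iter j F x) ∎

  commute : ∀ {f g F G : A → A} → AgreesOn P f F → AgreesOn P g G →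
            (∀ x → F (G x) ≡ G (F x)) → ∀ x → P x → f (g x) ≡ g (f x)
  commute {f} {g} {F} {G} f≈F g≈G FG≡GF x p = begin
    f (g x) ≡⟨ cong f (agree g≈G x p) ⟩
    f (G x) ≡⟨ agree f≈F (G x) (preserve g≈G x p) ⟩
    F (G x) ≡⟨ FG≡GF x ⟩
    G (F x) ≡⟨ sym (agree g≈G (F x) (preserve f≈F x p)) ⟩
    g (F x) ≡⟨ cong g (sym (agree f≈F x p)) ⟩
    g (f x) ∎

shift : ∀ {m} → ℤ → Vec ℤ m → Vec ℤ m
shift c = Vec.map (_+ c)

rotate : ∀ {m} → ℕ → Vec ℤ m → Vec ℤ m
rotate b []       = []
rotate b (x ∷ xs) = xs ∷ʳ (x - + b)

x-b+c≡x+c-b : ∀ x b c → x - b + c ≡ x + c - b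
x-b+c≡x+c-b = solve-∀

shift-zero : ∀ {m} (v : Vec ℤ m) → shift 0ℤ v ≡ v
shift-zero v = trans (Vecₚ.map-cong ℤₚ.+-identityʳ v) (Vecₚ.map-id v)

shift-shift : ∀ {m} c c′ (v : Vec ℤ m) → shift c (shift c′ v) ≡ shift (c′ + c) v
shift-shift c c′ v =
  trans (sym (Vecₚ.map-∘ (_+ c) (_+ c′) v)) (Vecₚ.map-cong (λ x → ℤₚ.+-assoc x c′ c) v)

iter-shift : ∀ {m} j c (v : Vec ℤ m) → iter j (shift c) v ≡ shift (+ j * c) v
iter-shift zero    c v = sym (trans (cong (λ c′ → shift c′ v) (ℤₚ.*-zeroˡ c)) (shift-zero v))
iter-shift (suc j) c v = begin
  shift c (iter j (shift c) v) ≡⟨ cong (shift c) (iter-shift j c v) ⟩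
  shift c (shift (+ j * c) v)  ≡⟨ shift-shift c (+ j * c) v ⟩
  shift (+ j * c + c) v        ≡⟨ cong (λ c′ → shift c′ v) (jc+c≡[1+j]c (+ j) c) ⟩
  shift (+ suc j * c) v        ∎
  where
  jc+c≡[1+j]c : ∀ j c → j * c + c ≡ (1ℤ + j) * c
  jc+c≡[1+j]c = solve-∀

shift-cancel₃ : ∀ {m} c₁ c₂ c₃ (v : Vec ℤ m) → c₁ + c₂ + c₃ ≡ 0ℤ →
                shift c₃ (shift c₂ (shift c₁ v)) ≡ v
shift-cancel₃ c₁ c₂ c₃ v sum≡0 = begin
  shift c₃ (shift c₂ (shift c₁ v)) ≡⟨ cong (shift c₃) (shift-shift c₂ c₁ v) ⟩
  shift c₃ (shift (c₁ + c₂) v)     ≡⟨ shift-shift c₃ (c₁ + c₂) v ⟩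
  shift (c₁ + c₂ + c₃) v           ≡⟨ cong (λ c → shift c v) sum≡0 ⟩
  shift 0ℤ v                       ≡⟨ shift-zero v ⟩
  v                                ∎

shift-rotate : ∀ {m} b c (v : Vec ℤ m) → shift c (rotate b v) ≡ rotate b (shift c v)
shift-rotate b c []       = refl
shift-rotate b c (x ∷ xs) = begin
  shift c (xs ∷ʳ (x - + b))   ≡⟨ Vecₚ.map-∷ʳ (_+ c) (x - + b) xs ⟩
  shift c xs ∷ʳ (x - + b + c) ≡⟨ cong (shift c xs ∷ʳ_) (x-b+c≡x+c-b x (+ b) c) ⟩
  shift c xs ∷ʳ (x + c - + b) ∎

rotateList : ℕ → List ℤ → List ℤ
rotateList b List.[]       = List.[]
rotateList b (x List.∷ xs) = xs ++ List.[ x - + b ]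

-- Stated on lists because, as vectors, the two sides would have the non-convertible lengths m + k and k + m.
iter-rotateList : ∀ b (xs ys : List ℤ) →
                  iter (length xs) (rotateList b) (xs ++ ys) ≡ ys ++ List.map (_- + b) xs
iter-rotateList b List.[]       ys = sym (Listₚ.++-identityʳ ys)
iter-rotateList b (x List.∷ xs) ys = begin
  iter (suc (length xs)) (rotateList b) (x List.∷ xs ++ ys)
    ≡⟨ iter-suc (length xs) (rotateList b) _ ⟩
  iter (length xs) (rotateList b) ((xs ++ ys) ++ List.[ x - + b ])
    ≡⟨ cong (iter (length xs) (rotateList b)) (Listₚ.++-assoc xs ys _) ⟩
  iter (length xs) (rotateList b) (xs ++ ys ++ List.[ x - + b ])
    ≡⟨ iter-rotateList b xs _ ⟩
  (ys ++ List.[ x - + b ]) ++ List.map (_- + b) xs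
    ≡⟨ Listₚ.++-assoc ys _ _ ⟩
  ys ++ List.map (_- + b) (x List.∷ xs) ∎

toList-rotate : ∀ {m} b (v : Vec ℤ m) → toList (rotate b v) ≡ rotateList b (toList v)
toList-rotate b []       = refl
toList-rotate b (x ∷ xs) = Vecₚ.toList-∷ʳ (x - + b) xs

iter-rotate : ∀ {m} b (v : Vec ℤ m) → iter m (rotate b) v ≡ shift (- + b) v
iter-rotate {m} b v = trans (sym (Vecₚ.cast-is-id refl _)) (Vecₚ.toList-injective refl _ _ (begin
  toList (iter m (rotate b) v)
    ≡⟨ iter-intertwine toList (toList-rotate b) m v ⟩
  iter m (rotateList b) (toList v)
    ≡⟨ cong (λ j → iter j (rotateList b) (toList v)) (sym (Vecₚ.length-toList v)) ⟩
  iter (length (toList v)) (rotateList b) (toList v)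
    ≡⟨ cong (iter (length (toList v)) (rotateList b)) (sym (Listₚ.++-identityʳ (toList v))) ⟩
  iter (length (toList v)) (rotateList b) (toList v ++ List.[])
    ≡⟨ iter-rotateList b (toList v) List.[] ⟩
  List.map (_- + b) (toList v)
    ≡⟨ sym (Vecₚ.toList-map (_- + b) v) ⟩
  toList (shift (- + b) v) ∎))

HeadWithin : ∀ {m} → ℕ → Vec ℤ m → Set
HeadWithin b []       = ⊤
HeadWithin b (x ∷ xs) = All (x - + b ℤ.≤_) xs

DescendingWithin : ∀ {m} → ℕ → Vec ℤ m → Set
DescendingWithin b v = Linked _≥_ v × HeadWithin b v

decreasing⇒linked : ∀ {m} (v : Vec ℤ m) → Decreasing v → Linked _≥_ v
decreasing⇒linked []           _ = []
decreasing⇒linked (x ∷ [])     _ = [-]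
decreasing⇒linked (x ∷ y ∷ ys) D =
  D zero (suc zero) ℕ.z≤n ∷ decreasing⇒linked (y ∷ ys) (λ i j i≤j → D (suc i) (suc j) (ℕ.s≤s i≤j))

i-j≤k⇒i-k≤j : ∀ {i j} k → i - j ℤ.≤ k → i - k ℤ.≤ j
i-j≤k⇒i-k≤j {i} {j} k i-j≤k = subst₂ ℤ._≤_ (cancelʳ i j k) (cancelˡ j k) (ℤₚ.+-monoˡ-≤ (j - k) i-j≤k)
  where
  cancelʳ : ∀ i j k → i - j + (j - k) ≡ i - k
  cancelʳ = solve-∀
  cancelˡ : ∀ j k → k + (j - k) ≡ j
  cancelˡ = solve-∀

spreadAtMost⇒headWithin : ∀ {m} b (v : Vec ℤ m) → SpreadAtMost b v → HeadWithin b v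
spreadAtMost⇒headWithin b []       _ = tt
spreadAtMost⇒headWithin b (x ∷ xs) S = Allₚ.lookup⁻ (λ i → i-j≤k⇒i-k≤j {x} (+ b) (S zero (suc i)))

shift-linked : ∀ {m} c {v : Vec ℤ m} → Linked _≥_ v → Linked _≥_ (shift c v)
shift-linked c = Linkedₚ.map⁺ ∘ Linked.map (ℤₚ.+-monoˡ-≤ c)

shift-descendingWithin : ∀ {m} b c {v : Vec ℤ m} → DescendingWithin b v → DescendingWithin b (shift c v)
shift-descendingWithin b c {[]}     (l , _) = [] , tt
shift-descendingWithin b c {x ∷ xs} (l , h) =
  shift-linked c l , Allₚ.map⁺ (All.map (subst (ℤ._≤ _) (x-b+c≡x+c-b x (+ b) c) ∘ ℤₚ.+-monoˡ-≤ c) h)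

∷ʳ⁺ : ∀ {A : Set} {P : A → Set} {m} {xs : Vec A m} {z} → All P xs → P z → All P (xs ∷ʳ z)
∷ʳ⁺ []         pz = pz ∷ []
∷ʳ⁺ (px ∷ pxs) pz = px ∷ ∷ʳ⁺ pxs pz

linked-∷ʳ⁺ : ∀ {A : Set} {R : A → A → Set} {m} {xs : Vec A m} {z} →
             Linked R xs → All (λ y → R y z) xs → Linked R (xs ∷ʳ z)
linked-∷ʳ⁺                      []          []         = [-]
linked-∷ʳ⁺                      [-]         (Rxz ∷ []) = Rxz ∷ [-]
linked-∷ʳ⁺ {xs = x ∷ y ∷ ys} (Rxy ∷ Rys) (_ ∷ Rysz)  = Rxy ∷ linked-∷ʳ⁺ Rys Rysz

rotate-descendingWithin : ∀ {m} b {v : Vec ℤ m} → DescendingWithin b v → DescendingWithin b (rotate b v)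
rotate-descendingWithin b {[]}     _       = [] , tt
rotate-descendingWithin b {x ∷ xs} (l , h) = linked-∷ʳ⁺ (Linked.tail l) h , headWithin xs l h
  where
  headWithin : ∀ {m} (xs : Vec ℤ m) → Linked _≥_ (x ∷ xs) → HeadWithin b (x ∷ xs) →
               HeadWithin b (xs ∷ʳ (x - + b))
  headWithin []        _           _       = []
  headWithin (y ∷ ys) (x≥y ∷ _) (_ ∷ h) =
    All.map (ℤₚ.≤-trans (ℤₚ.+-monoˡ-≤ (- + b) x≥y)) (∷ʳ⁺ h ℤₚ.≤-refl)

insert-descending : ∀ {m x} {ys : Vec ℤ m} → Linked _≥_ (x ∷ ys) → insert x ys ≡ x ∷ ys
insert-descending {ys = []}     [-]       = refl
insert-descending {x = x} {ys = y ∷ ys} (x≥y ∷ _) with y ≤? x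
... | yes _   = refl
... | no  y≰x = ⊥-elim (y≰x x≥y)

sortVec-descending : ∀ {m} {v : Vec ℤ m} → Linked _≥_ v → sortVec v ≡ v
sortVec-descending {v = []}     []  = refl
sortVec-descending {v = x ∷ xs} l =
  trans (cong (insert x) (sortVec-descending (Linked.tail l))) (insert-descending l)

insert-below : ∀ {m} x {ys : Vec ℤ m} → Linked _≥_ ys → All (x ℤ.≤_) ys → insert x ys ≡ ys ∷ʳ x
insert-below x {[]}     []  []          = refl
insert-below x {y ∷ ys} l   (x≤y ∷ x≤ys) with y ≤? x
... | no  _   = cong (y ∷_) (insert-below x (Linked.tail l) x≤ys)
... | yes y≤x with ℤₚ.≤-antisym x≤y y≤x
-- x = y, and placing x just before y or just after it gives the same vector.
...   | refl  = cong (x ∷_) (trans (sym (insert-descending l)) (insert-below x (Linked.tail l) x≤ys))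

argmax-descending : ∀ {m} {v : Vec ℤ (suc m)} → Linked _≥_ v → argmax v ≡ zero
argmax-descending [-] = refl
argmax-descending {v = x ∷ y ∷ ys} (x≥y ∷ l) with Vec.lookup (y ∷ ys) (argmax (y ∷ ys)) ≤? x
... | yes _   = refl
... | no  x≱m = ⊥-elim (x≱m (subst (λ i → Vec.lookup (y ∷ ys) i ℤ.≤ x) (sym (argmax-descending l)) x≥y))

bump-zero : ∀ {m} x (xs : Vec ℤ m) a e → bump (x ∷ xs) zero a e ≡ x + a ∷ shift e xs
bump-zero x xs a e = cong (x + a ∷_)
  (trans (Vecₚ.tabulate-∘ (_+ e) (Vec.lookup xs)) (cong (shift e) (Vecₚ.tabulate∘lookup xs)))

sortVec-bump-argmax : ∀ {m} b {a e} {v : Vec ℤ (suc m)} → a + + b ≡ e → DescendingWithin b v →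
                      sortVec (bump v (argmax v) a e) ≡ shift e (rotate b v)
sortVec-bump-argmax b {a} {v = x ∷ xs} refl (l , h) = begin
  sortVec (bump (x ∷ xs) (argmax (x ∷ xs)) a e)
    ≡⟨ cong (λ i → sortVec (bump (x ∷ xs) i a e)) (argmax-descending l) ⟩
  sortVec (bump (x ∷ xs) zero a e)
    ≡⟨ cong sortVec (bump-zero x xs a e) ⟩
  insert (x + a) (sortVec (shift e xs))
    ≡⟨ cong (insert (x + a)) (sortVec-descending tail-descending) ⟩
  insert (x + a) (shift e xs)
    ≡⟨ cong (λ z → insert z (shift e xs)) (x+a≡x-b+[a+b] x a (+ b)) ⟩
  insert (x - + b + e) (shift e xs)
    ≡⟨ insert-below (x - + b + e) tail-descending (Allₚ.map⁺ (All.map (ℤₚ.+-monoˡ-≤ e) h)) ⟩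
  shift e xs ∷ʳ (x - + b + e)
    ≡⟨ sym (Vecₚ.map-∷ʳ (_+ e) (x - + b) xs) ⟩
  shift e (xs ∷ʳ (x - + b)) ∎
  where
  e : ℤ
  e = a + + b
  tail-descending : Linked _≥_ (shift e xs)
  tail-descending = shift-linked e (Linked.tail l)
  x+a≡x-b+[a+b] : ∀ x a b → x + a ≡ x - b + (a + b)
  x+a≡x-b+[a+b] = solve-∀

SortedCompact : ∀ {n d} → Config n d → Set
SortedCompact {n} {d} (k , w) = DescendingWithin (n ℕ.+ d ℕ.+ 1) k × DescendingWithin (n ℕ.+ 1) w

sorted∧compact⇒sortedCompact : ∀ {n d} (u : Config n d) → Sorted u → Compact u → SortedCompact u
sorted∧compact⇒sortedCompact (k , w) (dk , dw) (ck , cw) =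
  (decreasing⇒linked k dk , spreadAtMost⇒headWithin _ k ck) ,
  (decreasing⇒linked w dw , spreadAtMost⇒headWithin _ w cw)

shiftAll : ∀ {n d} → Config n d → Config n d
shiftAll = Product.map (shift 1ℤ) (shift 1ℤ)

-- Toppling the head of K costs it n + d grains; this is written as a loss of n + d + 1
-- followed by the gain of 1 shared by every vertex of K.
rotateK : ∀ {n d} → Config n d → Config n d
rotateK {n} {d} = Product.map (shift 1ℤ ∘ rotate (n ℕ.+ d ℕ.+ 1)) (shift 1ℤ)

rotateI : ∀ {n d} → Config n d → Config n d
rotateI {n} = Product.map (shift 1ℤ) (rotate (n ℕ.+ 1))

shiftAll-sortedCompact : ∀ {n d} (u : Config n d) → SortedCompact u → SortedCompact (shiftAll u)
shiftAll-sortedCompact _ (dk , dw) = shift-descendingWithin _ 1ℤ dk , shift-descendingWithin _ 1ℤ dw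

rotateK-sortedCompact : ∀ {n d} (u : Config n d) → SortedCompact u → SortedCompact (rotateK u)
rotateK-sortedCompact _ (dk , dw) =
  shift-descendingWithin _ 1ℤ (rotate-descendingWithin _ dk) , shift-descendingWithin _ 1ℤ dw

rotateI-sortedCompact : ∀ {n d} (u : Config n d) → SortedCompact u → SortedCompact (rotateI u)
rotateI-sortedCompact _ (dk , dw) = shift-descendingWithin _ 1ℤ dk , rotate-descendingWithin _ dw

T-s-agrees : ∀ {n d} → AgreesOn (SortedCompact {n} {d}) T-s shiftAll
T-s-agrees = record
  { agree    = λ _ ((lk , _) , (lw , _)) →
      cong₂ _,_ (sortVec-descending (shift-linked 1ℤ lk)) (sortVec-descending (shift-linked 1ℤ lw))
  ; preserve = shiftAll-sortedCompact
  }

T-K-agrees : ∀ {n d} → AgreesOn (SortedCompact {suc n} {d}) T-K rotateK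
T-K-agrees {n} {d} = record
  { agree    = λ _ (dk , (lw , _)) →
      cong₂ _,_ (sortVec-bump-argmax _ (loss+b≡gain (+ (suc n ℕ.+ d))) dk)
                (sortVec-descending (shift-linked 1ℤ lw))
  ; preserve = rotateK-sortedCompact
  }
  where
  loss+b≡gain : ∀ x → - x + (x + 1ℤ) ≡ 1ℤ
  loss+b≡gain = solve-∀

T-I-agrees : ∀ {n d} → AgreesOn (SortedCompact {n} {suc d}) T-I rotateI
T-I-agrees {n} = record
  { agree    = λ _ ((lk , _) , dw) →
      cong₂ _,_ (sortVec-descending (shift-linked 1ℤ lk))
                (trans (sortVec-bump-argmax _ (ℤₚ.+-inverseˡ (+ (n ℕ.+ 1))) dw) (shift-zero _))
  ; preserve = rotateI-sortedCompact
  }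

shiftAll-rotateK : ∀ {n d} (u : Config n d) → shiftAll (rotateK u) ≡ rotateK (shiftAll u)
shiftAll-rotateK (k , w) = cong₂ _,_ (cong (shift 1ℤ) (shift-rotate _ 1ℤ k)) refl

shiftAll-rotateI : ∀ {n d} (u : Config n d) → shiftAll (rotateI u) ≡ rotateI (shiftAll u)
shiftAll-rotateI (k , w) = cong₂ _,_ refl (shift-rotate _ 1ℤ w)

rotateK-rotateI : ∀ {n d} (u : Config n d) → rotateK (rotateI u) ≡ rotateI (rotateK u)
rotateK-rotateI (k , w) = cong₂ _,_ (cong (shift 1ℤ) (sym (shift-rotate _ 1ℤ k))) (shift-rotate _ 1ℤ w)

iter-rotateK : ∀ {n d} (k : Vec ℤ n) (w : Vec ℤ d) →
               iter n rotateK (k , w) ≡ (shift (+ n * 1ℤ) (shift (- + (n ℕ.+ d ℕ.+ 1)) k) , shift (+ n * 1ℤ) w)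
iter-rotateK {n} {d} k w = begin
  iter n rotateK (k , w)
    ≡⟨ iter-map _ _ n (k , w) ⟩
  (iter n (shift 1ℤ ∘ rotate b) k , iter n (shift 1ℤ) w)
    ≡⟨ cong₂ _,_ (iter-∘ (λ x → sym (shift-rotate b 1ℤ x)) n k) (iter-shift n 1ℤ w) ⟩
  (iter n (shift 1ℤ) (iter n (rotate b) k) , shift (+ n * 1ℤ) w)
    ≡⟨ cong₂ _,_ (trans (iter-shift n 1ℤ _) (cong (shift (+ n * 1ℤ)) (iter-rotate b k))) refl ⟩
  (shift (+ n * 1ℤ) (shift (- + b) k) , shift (+ n * 1ℤ) w) ∎
  where
  b : ℕ
  b = n ℕ.+ d ℕ.+ 1

iter-rotateI : ∀ {n d} (k : Vec ℤ n) (w : Vec ℤ d) →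
               iter d rotateI (k , w) ≡ (shift (+ d * 1ℤ) k , shift (- + (n ℕ.+ 1)) w)
iter-rotateI {n} {d} k w =
  trans (iter-map _ _ d (k , w)) (cong₂ _,_ (iter-shift d 1ℤ k) (iter-rotate (n ℕ.+ 1) w))

shiftAll∘rotateKⁿ∘rotateIᵈ : ∀ {n d} (u : Config n d) → shiftAll (iter n rotateK (iter d rotateI u)) ≡ u
shiftAll∘rotateKⁿ∘rotateIᵈ {n} {d} (k , w) = begin
  shiftAll (iter n rotateK (iter d rotateI (k , w)))
    ≡⟨ cong (shiftAll ∘ iter n rotateK) (iter-rotateI k w) ⟩
  shiftAll (iter n rotateK (shift (+ d * 1ℤ) k , shift (- + (n ℕ.+ 1)) w))
    ≡⟨ cong shiftAll (iter-rotateK _ _) ⟩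
  (shift 1ℤ (shift (+ n * 1ℤ) (shift (- + (n ℕ.+ d ℕ.+ 1)) (shift (+ d * 1ℤ) k))) ,
   shift 1ℤ (shift (+ n * 1ℤ) (shift (- + (n ℕ.+ 1)) w)))
    ≡⟨ cong₂ _,_ (trans (cong (shift 1ℤ ∘ shift (+ n * 1ℤ)) (shift-shift _ (+ d * 1ℤ) k))
                        (shift-cancel₃ _ _ _ k (K-balance (+ n) (+ d))))
                 (shift-cancel₃ _ _ _ w (I-balance (+ n))) ⟩
  (k , w) ∎
  where
  K-balance : ∀ n d → d * 1ℤ + - (n + d + 1ℤ) + n * 1ℤ + 1ℤ ≡ 0ℤ
  K-balance = solve-∀
  I-balance : ∀ n → - (n + 1ℤ) + n * 1ℤ + 1ℤ ≡ 0ℤ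
  I-balance = solve-∀

T-s∘T-I≡T-I∘T-s : ∀ {n d} (u : Config n d) → SortedCompact u → T-s (T-I u) ≡ T-I (T-s u)
T-s∘T-I≡T-I∘T-s {d = zero}  _ _ = refl
T-s∘T-I≡T-I∘T-s {d = suc d} u p = commute T-s-agrees T-I-agrees shiftAll-rotateI u p

T-K∘T-I≡T-I∘T-K : ∀ {n d} (u : Config (suc n) d) → SortedCompact u → T-K (T-I u) ≡ T-I (T-K u)
T-K∘T-I≡T-I∘T-K {d = zero}  _ _ = refl
T-K∘T-I≡T-I∘T-K {d = suc d} u p = commute T-K-agrees T-I-agrees rotateK-rotateI u p

iter-T-I : ∀ {n d} (u : Config n d) → SortedCompact u → iter d T-I u ≡ iter d rotateI u
iter-T-I {d = zero}  _ _ = refl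
iter-T-I {d = suc d} u p = iter-agrees T-I-agrees (suc d) u p

T-s∘T-Kⁿ∘T-Iᵈ : ∀ {n d} (u : Config (suc n) d) → SortedCompact u →
                T-s (iter (suc n) T-K (iter d T-I u)) ≡ u
T-s∘T-Kⁿ∘T-Iᵈ {n} {d} u p = begin
  T-s (iter (suc n) T-K (iter d T-I u))
    ≡⟨ cong (T-s ∘ iter (suc n) T-K) (iter-T-I u p) ⟩
  T-s (iter (suc n) T-K v)
    ≡⟨ cong T-s (iter-agrees T-K-agrees (suc n) v pv) ⟩
  T-s (iter (suc n) rotateK v)
    ≡⟨ agree T-s-agrees _ (iter-preserves rotateK-sortedCompact (suc n) v pv) ⟩
  shiftAll (iter (suc n) rotateK v)
    ≡⟨ shiftAll∘rotateKⁿ∘rotateIᵈ u ⟩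
  u ∎
  where
  v : Config (suc n) d
  v = iter d rotateI u
  pv : SortedCompact v
  pv = iter-preserves rotateI-sortedCompact d u p

proposition5p5 : (n d : ℕ) → 1 ≤ n → (u : Config n d) → Sorted u → Compact u →
      (T-s (T-K u) ≡ T-K (T-s u))
    × (T-s (T-I u) ≡ T-I (T-s u))
    × (T-K (T-I u) ≡ T-I (T-K u))
    × (T-s (iter n T-K (iter d T-I u)) ≡ u)
proposition5p5 zero    d ()
proposition5p5 (suc n) d _ u sorted compact =
    commute T-s-agrees T-K-agrees shiftAll-rotateK u p
  , T-s∘T-I≡T-I∘T-s u p
  , T-K∘T-I≡T-I∘T-K u p
  , T-s∘T-Kⁿ∘T-Iᵈ u p
  where p = sorted∧compact⇒sortedCompact u sorted compact
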